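{- Let $A$ be a finite alphabet and $M \subseteq A^*$ a regular language such that for every $n\in\mathbb{N}$ there exists a word $w\in M$ of length $n$. Then there exists a regular language $M' \subseteq M$ such that for every $n \in\mathbb{N}$ there exists exactly one word $w \in M'$ of length $n$. -}

module Defs where

open import Data.Nat using (ℕ)
open import Data.Fin using (Fin)
open import Data.Bool using (Bool; true)
open import Data.List using (List; []; _∷_; length)
open import Data.Product using (Σ; ∃; _×_; _,_)
open import Relation.Binary.PropositionalEquality using (_≡_)
open import Function.Bundles using (_⇔_)

Word : ℕ → Set
Word k = List (Fin k)

Language : ℕ → Set₁
Language k = Word k → Set

record DFA (k : ℕ) : Set where
  field
    m      : ℕ
    start  : Fin m
    δ      : Fin m → Fin k → Fin m
    final  : Fin m → Bool

run : ∀ {k} (D : DFA k) → Fin (DFA.m D) → Word k → Fin (DFA.m D)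
run D q []       = q
run D q (a ∷ w)  = run D (DFA.δ D q a) w

Accepts : ∀ {k} → DFA k → Word k → Set
Accepts D w = DFA.final D (run D (DFA.start D) w) ≡ true

Regular : ∀ {k} → Language k → Set
Regular {k} L = Σ (DFA k) λ D → ∀ w → L w ⇔ Accepts D w

_⊆L_ : ∀ {k} → Language k → Language k → Set
L ⊆L L' = ∀ w → L w → L' w

-- Take M' to be the lexicographically least word of each length in M.  A DFA for
-- M' runs the DFA D of M and, beside D's current state, the set of states that D
-- reaches on the words of the same length that are lexicographically smaller than
-- the prefix read so far; it accepts when D accepts and no state of that set is
-- accepting.  Since M is decidable and contains a word of every length, a least
-- word of every length exists, and trichotomy of the lexicographic order makes it
-- unique.
module Submission where

open import Defs
open import Data.Nat using (ℕ; zero; suc; _*_; _^_; s≤s)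
open import Data.Nat.Properties using (suc-injective)
open import Data.Bool using (true) renaming (_≟_ to _≟ᵇ_)
open import Data.Fin using (Fin; zero; suc; _<_; combine; remQuot; funToFin; finToFun)
open import Data.Fin.Properties
  using (_≟_; _<?_; <-cmp; any?; remQuot-combine; finToFun-funToFin; 2↔Bool)
open import Data.Fin.Subset using (Subset; _∈_; ⊥)
open import Data.Fin.Subset.Properties using (_∈?_; ∉⊥)
open import Data.List using ([]; _∷_; length)
open import Data.List.Relation.Binary.Lex.Strict using (Lex-<; base; this; next; <-compare)
open import Data.List.Relation.Binary.Pointwise using (Pointwise-≡⇒≡)
open import Data.Product using (Σ; ∃; _×_; _,_; proj₁; proj₂; map₂)
open import Data.Sum using (_⊎_; inj₁; inj₂)
open import Data.Vec using (lookup; tabulate)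
open import Data.Vec.Properties using (lookup∘tabulate; tabulate∘lookup; tabulate-cong; []=⇒lookup; lookup⇒[]=)
open import Function using (_∘_)
open import Function.Bundles using (_⇔_; mk⇔; Equivalence; Inverse)
import Function.Properties.Equivalence as ⇔
open import Level using (Level)
open import Relation.Binary using (tri<; tri≈; tri>)
open import Relation.Binary.PropositionalEquality using (_≡_; refl; sym; trans; cong; subst)
open import Relation.Nullary using (Dec; yes; no; does; ¬_; contradiction)
open import Relation.Nullary.Decidable using (dec-true; ¬?; _×-dec_; _⊎-dec_)
import Relation.Nullary.Decidable as Dec
open import Relation.Unary using (Pred; Decidable)

open Equivalence using (to; from)

private
  variable
    ℓ : Level
    k n : ℕ
    A : Set ℓ
    L L′ : Language k

does≡true⇔ : (a? : Dec A) → does a? ≡ true ⇔ A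
does≡true⇔ a? = mk⇔ (witness a?) (dec-true a?)
  where
  witness : (a? : Dec A) → does a? ≡ true → A
  witness (yes a) _ = a

∃-smallest : {P : Pred (Fin n) ℓ} → Decidable P → ∃ P → ∃ λ b → P b × (∀ c → c < b → ¬ P c)
∃-smallest {n = suc n} P? (a , pa) with P? zero
... | yes p₀ = zero , p₀ , λ _ ()
∃-smallest P? (zero  , p₀) | no ¬p₀ = contradiction p₀ ¬p₀
∃-smallest P? (suc a , pa) | no ¬p₀ with ∃-smallest (P? ∘ suc) (a , pa)
... | b , pb , below = suc b , pb , λ { zero _ → ¬p₀ ; (suc c) (s≤s c<b) → below c c<b }

subsetOf : {P : Pred (Fin n) ℓ} → Decidable P → Subset n
subsetOf P? = tabulate (does ∘ P?)

∈-subsetOf : {P : Pred (Fin n) ℓ} (P? : Decidable P) {t : Fin n} → t ∈ subsetOf P? ⇔ P t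
∈-subsetOf P? {t} = ⇔.trans lookup≡true (does≡true⇔ (P? t))
  where
  lookup≡true : t ∈ subsetOf P? ⇔ does (P? t) ≡ true
  lookup≡true = mk⇔ (λ t∈ → trans (sym (lookup∘tabulate (does ∘ P?) t)) ([]=⇒lookup t∈))
                    (λ eq → lookup⇒[]= t _ (trans (lookup∘tabulate (does ∘ P?) t) eq))

encodeSubset : Subset n → Fin (2 ^ n)
encodeSubset S = funToFin (Inverse.from 2↔Bool ∘ lookup S)

decodeSubset : Fin (2 ^ n) → Subset n
decodeSubset i = tabulate (Inverse.to 2↔Bool ∘ finToFun i)

decodeSubset-encodeSubset : (S : Subset n) → decodeSubset (encodeSubset S) ≡ S
decodeSubset-encodeSubset S = trans (tabulate-cong decode-lookup) (tabulate∘lookup S)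
  where
  decode-lookup : ∀ t → Inverse.to 2↔Bool (finToFun (encodeSubset S) t) ≡ lookup S t
  decode-lookup t = trans (cong (Inverse.to 2↔Bool) (finToFun-funToFin _ t))
                          (Inverse.strictlyInverseˡ 2↔Bool (lookup S t))

Regular⇒Decidable : Regular L → Decidable L
Regular⇒Decidable (D , L⇔D) w =
  Dec.map (⇔.sym (L⇔D w)) (DFA.final D (run D (DFA.start D) w) ≟ᵇ true)

record EncodedAutomaton (k : ℕ) : Set₁ where
  field
    State         : Set
    initial       : State
    step          : State → Fin k → State
    Accept        : State → Set
    accept?       : Decidable Accept
    size          : ℕ
    encode        : State → Fin size
    decode        : Fin size → State
    decode-encode : ∀ q → decode (encode q) ≡ q

  runᴬ : State → Word k → State
  runᴬ q []      = q
  runᴬ q (a ∷ w) = runᴬ (step q a) w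

  toDFA : DFA k
  toDFA = record
    { m     = size
    ; start = encode initial
    ; δ     = λ i a → encode (step (decode i) a)
    ; final = does ∘ accept? ∘ decode
    }

  run-toDFA : ∀ q w → run toDFA (encode q) w ≡ encode (runᴬ q w)
  run-toDFA q []      = refl
  run-toDFA q (a ∷ w) rewrite decode-encode q = run-toDFA (step q a) w

  decode-run-toDFA : ∀ q w → decode (run toDFA (encode q) w) ≡ runᴬ q w
  decode-run-toDFA q w = trans (cong decode (run-toDFA q w)) (decode-encode (runᴬ q w))

  regular : (∀ w → L w ⇔ Accept (runᴬ initial w)) → Regular L
  regular L⇔A = toDFA , λ w → ⇔.trans (L⇔A w)
    (subst (λ q → Accept q ⇔ Accepts toDFA w) (decode-run-toDFA initial w) (⇔.sym (does≡true⇔ (accept? _))))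

_<ˡᵉˣ_ : Word k → Word k → Set
_<ˡᵉˣ_ = Lex-< _≡_ _<_

LexMin : Language k → Language k
LexMin L w = L w × (∀ v → length v ≡ length w → v <ˡᵉˣ w → ¬ L v)

LexMin-cong : (∀ w → L w ⇔ L′ w) → ∀ w → LexMin L w ⇔ LexMin L′ w
LexMin-cong L⇔L′ w = mk⇔
  (λ (Lw , least) → to (L⇔L′ w) Lw , λ v eq v<w → least v eq v<w ∘ from (L⇔L′ v))
  (λ (Lw , least) → from (L⇔L′ w) Lw , λ v eq v<w → least v eq v<w ∘ to (L⇔L′ v))

LexMin-unique : ∀ {u v} → LexMin L u → LexMin L v → length u ≡ length v → u ≡ v
LexMin-unique {u = u} {v} (Lu , u-least) (Lv , v-least) |u|≡|v| with <-compare sym <-cmp u v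
... | tri< u<v _ _ = contradiction Lu (v-least u |u|≡|v| u<v)
... | tri≈ _ u≋v _ = Pointwise-≡⇒≡ u≋v
... | tri> _ _ v<u = contradiction Lv (u-least v (sym |u|≡|v|) v<u)

OfLength : ℕ → Language k → Set
OfLength n L = ∃ λ w → length w ≡ n × L w

ofLength? : Decidable L → ∀ n → Dec (OfLength n L)
ofLength? L? zero = Dec.map′ (λ L[] → [] , refl , L[]) (λ { ([] , _ , L[]) → L[] }) (L? [])
ofLength? L? (suc n) = Dec.map′
  (λ (a , w , |w|≡n , Law) → a ∷ w , cong suc |w|≡n , Law)
  (λ { (a ∷ w , |aw|≡sn , Law) → a , w , suc-injective |aw|≡sn , Law })
  (any? λ a → ofLength? (L? ∘ (a ∷_)) n)

-- The least word is built greedily: the least first letter that extends to a word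
-- of L, followed by the least such extension.
lexMin-exists : Decidable L → ∀ n → OfLength n L → OfLength n (LexMin L)
lexMin-exists L? zero ([] , _ , L[]) = [] , refl , L[] , λ { [] _ (base ()) }
lexMin-exists {L = L} L? (suc n) (a ∷ w , |aw|≡sn , Law)
  with ∃-smallest (λ b → ofLength? (L? ∘ (b ∷_)) n) (a , w , suc-injective |aw|≡sn , Law)
... | b , b-extends , b-least with lexMin-exists (L? ∘ (b ∷_)) n b-extends
... | u , |u|≡n , Lbu , u-least = b ∷ u , cong suc |u|≡n , Lbu , bu-least
  where
  bu-least : ∀ v → length v ≡ suc (length u) → v <ˡᵉˣ (b ∷ u) → ¬ L v
  bu-least (c ∷ v) eq (this c<b)      Lcv = b-least c c<b (v , trans (suc-injective eq) |u|≡n , Lcv)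
  bu-least (b ∷ v) eq (next refl v<u) Lbv = u-least v (suc-injective eq) v<u Lbv

module LexMinAutomaton (D : DFA k) where
  open DFA D

  -- A word of the current length that is below the prefix extended by a is either
  -- an extension of a word that was already below it, or it first differs at a.
  Successor : Fin m → Subset m → Fin k → Fin m → Set
  Successor q S a t = (∃ λ s → s ∈ S × ∃ λ b → δ s b ≡ t) ⊎ (∃ λ b → b < a × δ q b ≡ t)

  successor? : ∀ q S a → Decidable (Successor q S a)
  successor? q S a t = any? (λ s → s ∈? S ×-dec any? λ b → δ s b ≟ t)
                ⊎-dec any? (λ b → b <? a ×-dec δ q b ≟ t)

  State : Set
  State = Fin m × Subset m

  step : State → Fin k → State
  step (q , S) a = δ q a , subsetOf (successor? q S a)

  Accept : State → Set
  Accept (q , S) = final q ≡ true × ¬ (∃ λ t → t ∈ S × final t ≡ true)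

  accept? : Decidable Accept
  accept? (q , S) = final q ≟ᵇ true ×-dec ¬? (any? λ t → t ∈? S ×-dec final t ≟ᵇ true)

  automaton : EncodedAutomaton k
  automaton = record
    { State         = State
    ; initial       = start , ⊥
    ; step          = step
    ; Accept        = Accept
    ; accept?       = accept?
    ; size          = m * 2 ^ m
    ; encode        = λ (q , S) → combine q (encodeSubset S)
    ; decode        = map₂ decodeSubset ∘ remQuot (2 ^ m)
    ; decode-encode = λ (q , S) → trans (cong (map₂ decodeSubset) (remQuot-combine q (encodeSubset S)))
                                        (cong (q ,_) (decodeSubset-encodeSubset S))
    }

  open EncodedAutomaton automaton using (runᴬ; regular)

  Reach : Subset m → ℕ → Fin m → Set
  Reach S n t = ∃ λ s → s ∈ S × ∃ λ v → length v ≡ n × run D s v ≡ t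

  ReachBelow : Fin m → Word k → Fin m → Set
  ReachBelow q w t = ∃ λ v → length v ≡ length w × v <ˡᵉˣ w × run D q v ≡ t

  proj₁-runᴬ : ∀ q S w → proj₁ (runᴬ (q , S) w) ≡ run D q w
  proj₁-runᴬ q S []      = refl
  proj₁-runᴬ q S (a ∷ w) = proj₁-runᴬ (δ q a) _ w

  ∈-runᴬ⁺ : ∀ q S w {t} → Reach S (length w) t ⊎ ReachBelow q w t → t ∈ proj₂ (runᴬ (q , S) w)
  ∈-runᴬ⁺ q S [] (inj₁ (s , s∈S , [] , _ , refl)) = s∈S
  ∈-runᴬ⁺ q S [] (inj₁ (s , s∈S , _ ∷ _ , () , _))
  ∈-runᴬ⁺ q S [] (inj₂ (_ , _ , base () , _))
  ∈-runᴬ⁺ q S (a ∷ w) (inj₁ (s , s∈S , [] , () , _))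
  ∈-runᴬ⁺ q S (a ∷ w) (inj₁ (s , s∈S , b ∷ v , eq , reach)) = ∈-runᴬ⁺ (δ q a) _ w
    (inj₁ (δ s b , from (∈-subsetOf (successor? q S a)) (inj₁ (s , s∈S , b , refl)) , v , suc-injective eq , reach))
  ∈-runᴬ⁺ q S (a ∷ w) (inj₂ (b ∷ v , eq , this b<a , reach)) = ∈-runᴬ⁺ (δ q a) _ w
    (inj₁ (δ q b , from (∈-subsetOf (successor? q S a)) (inj₂ (b , b<a , refl)) , v , suc-injective eq , reach))
  ∈-runᴬ⁺ q S (a ∷ w) (inj₂ (a ∷ v , eq , next refl v<w , reach)) = ∈-runᴬ⁺ (δ q a) _ w
    (inj₂ (v , suc-injective eq , v<w , reach))

  ∈-runᴬ⁻ : ∀ q S w {t} → t ∈ proj₂ (runᴬ (q , S) w) → Reach S (length w) t ⊎ ReachBelow q w t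
  ∈-runᴬ⁻ q S [] {t} t∈S = inj₁ (t , t∈S , [] , refl , refl)
  ∈-runᴬ⁻ q S (a ∷ w) t∈ with ∈-runᴬ⁻ (δ q a) (subsetOf (successor? q S a)) w t∈
  ... | inj₂ (v , eq , v<w , reach) = inj₂ (a ∷ v , cong suc eq , next refl v<w , reach)
  ... | inj₁ (s , s∈ , v , eq , reach) with to (∈-subsetOf (successor? q S a)) s∈
  ...   | inj₁ (s₀ , s₀∈S , b , refl) = inj₁ (s₀ , s₀∈S , b ∷ v , cong suc eq , reach)
  ...   | inj₂ (b , b<a , refl)      = inj₂ (b ∷ v , cong suc eq , this b<a , reach)

  ∈-runᴬ-initial : ∀ w {t} → t ∈ proj₂ (runᴬ (start , ⊥) w) ⇔ ReachBelow start w t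
  ∈-runᴬ-initial w = mk⇔ reachBelow (∈-runᴬ⁺ start ⊥ w ∘ inj₂)
    where
    reachBelow : ∀ {t} → t ∈ proj₂ (runᴬ (start , ⊥) w) → ReachBelow start w t
    reachBelow t∈ with ∈-runᴬ⁻ start ⊥ w t∈
    ... | inj₁ (_ , s∈⊥ , _) = contradiction s∈⊥ ∉⊥
    ... | inj₂ below         = below

  Accept⇔LexMin : ∀ w → Accept (runᴬ (start , ⊥) w) ⇔ LexMin (Accepts D) w
  Accept⇔LexMin w = mk⇔
    (λ (final-q , none-below) →
        subst (λ q → final q ≡ true) (proj₁-runᴬ start ⊥ w) final-q
      , λ v eq v<w acc → none-below (_ , from (∈-runᴬ-initial w) (v , eq , v<w , refl) , acc))
    (λ (acc , least) →
        subst (λ q → final q ≡ true) (sym (proj₁-runᴬ start ⊥ w)) acc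
      , λ (t , t∈ , final-t) → let (v , eq , v<w , reach) = to (∈-runᴬ-initial w) t∈
                               in least v eq v<w (subst (λ q → final q ≡ true) (sym reach) final-t))

  regular-LexMin : Regular (LexMin (Accepts D))
  regular-LexMin = regular (⇔.sym ∘ Accept⇔LexMin)

LexMin-regular : Regular L → Regular (LexMin L)
LexMin-regular (D , L⇔D) with LexMinAutomaton.regular-LexMin D
... | D′ , LexMin⇔D′ = D′ , λ w → ⇔.trans (LexMin-cong L⇔D w) (LexMin⇔D′ w)

mainTheorem4 : (k : ℕ) (M : Language k) → Regular M
    → (∀ (n : ℕ) → ∃ λ (w : Word k) → length w ≡ n × M w)
    → Σ (Language k) λ M' → Regular M' × M' ⊆L M
    × (∀ (n : ℕ) → ∃ λ (w : Word k) → (length w ≡ n × M' w)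
    × (∀ (v : Word k) → length v ≡ n → M' v → v ≡ w))
mainTheorem4 _ M M-regular every-length =
  LexMin M , LexMin-regular M-regular , (λ _ → proj₁) , unique-of-length
  where
  unique-of-length : ∀ n → ∃ λ w → (length w ≡ n × LexMin M w) × (∀ v → length v ≡ n → LexMin M v → v ≡ w)
  unique-of-length n with lexMin-exists (Regular⇒Decidable M-regular) n (every-length n)
  ... | w , |w|≡n , w-least =
    w , (|w|≡n , w-least) , λ v |v|≡n v-least → LexMin-unique v-least w-least (trans |v|≡n (sym |w|≡n))
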